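{- Let $P$ be a normal logic program and $S$ a stable class of $P$. Then $\langle S\rangle^{st}_P$, the unique $\le_s$-minimal stable trap space $I$ of $P$ with $S\subseteq[I]$, is a stable partial model of $P$.
   Context: Fix a first-order language with finitely many constant, function and predicate symbols. A normal logic program (NLP) $P$ is a finite set of rules $p \leftarrow p_1,\dots,p_m, \mathord{\sim} p_{m+1},\dots,\mathord{\sim} p_k$ ($k\ge m\ge 0$). $\mathrm{HB}(P)$ is its Herbrand base (possibly infinite), $\mathrm{gr}(P)$ its ground instantiation; for a ground rule $r$: head $\mathrm{head}(r)$, positive/negative body atoms $B^+(r)$, $B^-(r)$, $\mathrm{bf}(r)=\bigwedge_{v\in B^+(r)}v\wedge\bigwedge_{v\in B^-(r)}\neg v$. A three-valued interpretation is a map $I:\mathrm{HB}(P)\to\{0,1,\star\}$; two-valued ones are identified with subsets of $\mathrm{HB}(P)$. $[I]=\{J\subseteq\mathrm{HB}(P): \forall a,\ I(a)\ne\star\Rightarrow J(a)=I(a)\}$; $\le_s$ is the pointwise order with $0<_s\star$, $1<_s\star$ only. Order $\le_t$: $0<_t\star<_t1$; Kleene evaluation ($\neg\star=\star$, $\wedge$ = $\le_t$-min). $I$ is a three-valued model of a program if $I(\mathrm{bf}(r))\le_t I(\mathrm{head}(r))$ for each ground rule. The reduct $P^I$: from $\mathrm{gr}(P)$ delete every rule with some $b\in B^-(r)$, $I(b)=1$; delete each $\mathord{\sim}b$ with $I(b)=0$; replace each remaining $\mathord{\sim}b$ by a special atom $\mathbf{u}$ always valued $\star$. $P^I$ has a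 unique $\le_t$-least three-valued model; $I$ is a stable partial model if it equals it. For two-valued $I$, $F_P(I)$ is the $\subseteq$-least model of the Gelfond–Lifschitz reduct (delete rules with some $b\in B^-(r)\cap I$, then delete remaining negative literals). A nonempty set $S$ of two-valued interpretations is a stable class if $S=\{F_P(J):J\in S\}$ and a stable trap set if $\{F_P(J):J\in S\}\subseteq S$; a three-valued $I$ is a stable trap space if $[I]$ is a stable trap set. For any nonempty set $S$ of two-valued interpretations, the set of stable trap spaces $I$ with $S\subseteq[I]$ has a unique $\le_s$-minimal element, denoted $\langle S\rangle^{st}_P$. -}

module Defs where

open import Data.Nat using (ℕ)
open import Data.Fin using (Fin)
open import Data.Vec using (Vec; []; _∷_)
open import Data.List using (List; []; _∷_; _++_; map; foldr)
open import Data.List.Relation.Unary.All using (All)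
open import Data.List.Membership.Propositional using (_∈_)
open import Data.Bool using (Bool; true; false)
open import Data.Empty using (⊥)
open import Data.Product using (Σ; ∃; _×_)
open import Data.Sum using (_⊎_)
open import Relation.Binary.PropositionalEquality using (_≡_)
open import Relation.Nullary using (¬_)

record Signature : Set where
  field
    nConst : ℕ
    nFun   : ℕ
    nPred  : ℕ
    funAr  : Fin nFun  → ℕ
    predAr : Fin nPred → ℕ

module _ (Σ' : Signature) where
  open Signature Σ'

  data Term (V : Set) : Set where
    var  : V → Term V
    cst  : Fin nConst → Term V
    fun  : (f : Fin nFun) → Vec (Term V) (funAr f) → Term V

  data Atom (V : Set) : Set where
    atom : (p : Fin nPred) → Vec (Term V) (predAr p) → Atom V

  GTerm : Set
  GTerm = Term ⊥

  HB : Set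
  HB = Atom ⊥

  -- a (non-ground) rule  p ← p₁,…,pₘ, ∼pₘ₊₁,…,∼pₖ  with variables Fin nVars
  record Rule : Set where
    field
      nVars : ℕ
      hd    : Atom (Fin nVars)
      pos   : List (Atom (Fin nVars))
      neg   : List (Atom (Fin nVars))

  Program : Set
  Program = List Rule

  mutual
    substT : {V : Set} → (V → GTerm) → Term V → GTerm
    substT σ (var x)    = σ x
    substT σ (cst c)    = cst c
    substT σ (fun f ts) = fun f (substTs σ ts)

    substTs : {V : Set} {n : ℕ} → (V → GTerm) → Vec (Term V) n → Vec GTerm n
    substTs σ []       = []
    substTs σ (t ∷ ts) = substT σ t ∷ substTs σ ts

  substA : {V : Set} → (V → GTerm) → Atom V → HB
  substA σ (atom p ts) = atom p (substTs σ ts)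

  record GRule : Set where
    constructor grule
    field
      head  : HB
      bpos  : List HB
      bneg  : List HB

  instantiate : (ρ : Rule) → (Fin (Rule.nVars ρ) → GTerm) → GRule
  instantiate ρ σ = grule (substA σ (Rule.hd ρ)) (map (substA σ) (Rule.pos ρ))
                          (map (substA σ) (Rule.neg ρ))

  -- gr(P): the ground rules of P, indexed by a rule of P and a ground
  -- substitution of its variables.
  GrIndex : Program → Set
  GrIndex P = Σ Rule (λ ρ → ρ ∈ P × (Fin (Rule.nVars ρ) → GTerm))

  gr : (P : Program) → GrIndex P → GRule
  gr P (ρ Data.Product., (_ Data.Product., σ)) = instantiate ρ σ

data V3 : Set where
  𝟎 𝟏 ⋆ : V3

data _≤t_ : V3 → V3 → Set where
  0≤ : ∀ {x} → 𝟎 ≤t x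
  ≤1 : ∀ {x} → x ≤t 𝟏
  ⋆≤⋆ : ⋆ ≤t ⋆

_∧₃_ : V3 → V3 → V3
𝟎 ∧₃ y = 𝟎
𝟏 ∧₃ y = y
⋆ ∧₃ 𝟎 = 𝟎
⋆ ∧₃ 𝟏 = ⋆
⋆ ∧₃ ⋆ = ⋆

conj : List V3 → V3
conj = foldr _∧₃_ 𝟏

_≤s_ : V3 → V3 → Set
x ≤s y = x ≡ y ⊎ y ≡ ⋆

toV3 : Bool → V3
toV3 true  = 𝟏
toV3 false = 𝟎

module Semantics (Σ' : Signature) where

  HB' : Set
  HB' = HB Σ'

  Interp3 : Set
  Interp3 = HB' → V3

  Interp2 : Set
  Interp2 = HB' → Bool

  _≤s-I_ : Interp3 → Interp3 → Set
  I ≤s-I J = ∀ a → I a ≤s J a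

  _≤t-I_ : Interp3 → Interp3 → Set
  I ≤t-I J = ∀ a → I a ≤t J a

  _∈[_] : Interp2 → Interp3 → Set
  J ∈[ I ] = ∀ a → ¬ (I a ≡ ⋆) → toV3 (J a) ≡ I a

  data RLit : Set where
    ratom : HB' → RLit
    u     : RLit

  negToU : Interp3 → List HB' → List RLit
  negToU I []       = []
  negToU I (b ∷ bs) with I b
  ... | 𝟎 = negToU I bs
  ... | 𝟏 = u ∷ negToU I bs
  ... | ⋆ = u ∷ negToU I bs

  KeptRed : Interp3 → GRule Σ' → Set
  KeptRed I r = All (λ b → ¬ (I b ≡ 𝟏)) (GRule.bneg r)

  reductBody : Interp3 → GRule Σ' → List RLit
  reductBody I r = map ratom (GRule.bpos r) ++ negToU I (GRule.bneg r)

  evalLit : Interp3 → RLit → V3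
  evalLit J (ratom a) = J a
  evalLit J u         = ⋆

  ModelOfReduct : Program Σ' → Interp3 → Interp3 → Set
  ModelOfReduct P I J =
    ∀ (k : GrIndex Σ' P) → KeptRed I (gr Σ' P k) →
      conj (map (evalLit J) (reductBody I (gr Σ' P k))) ≤t J (GRule.head (gr Σ' P k))

  StablePartialModel : Program Σ' → Interp3 → Set
  StablePartialModel P I =
    ModelOfReduct P I I × (∀ J → ModelOfReduct P I J → I ≤t-I J)

  KeptGL : Interp2 → GRule Σ' → Set
  KeptGL J r = All (λ b → ¬ (J b ≡ true)) (GRule.bneg r)

  ModelOfGL : Program Σ' → Interp2 → Interp2 → Set
  ModelOfGL P J K =
    ∀ (k : GrIndex Σ' P) → KeptGL J (gr Σ' P k) →
      All (λ b → K b ≡ true) (GRule.bpos (gr Σ' P k)) → K (GRule.head (gr Σ' P k)) ≡ true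

  IsF : Program Σ' → Interp2 → Interp2 → Set
  IsF P J K = ModelOfGL P J K × (∀ K' → ModelOfGL P J K' → ∀ a → K a ≡ true → K' a ≡ true)

  SetOfInterp : Set₁
  SetOfInterp = Interp2 → Set

  FImageSubset : Program Σ' → SetOfInterp → Set
  FImageSubset P S = ∀ J → S J → ∃ λ K → S K × IsF P J K

  SubsetFImage : Program Σ' → SetOfInterp → Set
  SubsetFImage P S = ∀ K → S K → ∃ λ J → S J × IsF P J K

  StableClass : Program Σ' → SetOfInterp → Set
  StableClass P S = (∃ λ J → S J) × FImageSubset P S × SubsetFImage P S

  StableTrapSet : Program Σ' → SetOfInterp → Set
  StableTrapSet P S = (∃ λ J → S J) × FImageSubset P S

  StableTrapSpace : Program Σ' → Interp3 → Set
  StableTrapSpace P I = StableTrapSet P (λ J → J ∈[ I ])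

  _⊆[_] : SetOfInterp → Interp3 → Set
  S ⊆[ I ] = ∀ J → S J → J ∈[ I ]

  IsStTrapClosure : Program Σ' → SetOfInterp → Interp3 → Set
  IsStTrapClosure P S I =
    StableTrapSpace P I × S ⊆[ I ] ×
    (∀ J → StableTrapSpace P J → S ⊆[ J ] → J ≤s-I I → ∀ a → J a ≡ I a)

{-# OPTIONS --safe #-}
-- A three-valued interpretation I is the interval [lower I, upper I] of two-valued
-- interpretations, where lower I is its true part and upper I its non-false part.
-- F_P is antitone, so for a stable trap space I it maps [I] into the interval
-- [F(upper I), F(lower I)] ⊆ [I]; that interval is again a stable trap space, it lies
-- ≤s-below I, and it contains S = F(S). Minimality of ⟨S⟩ therefore gives
-- lower I = F(upper I) and upper I = F(lower I). Such an alternating fixpoint is a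
-- stable partial model, because J models the reduct P^I exactly when lower J models
-- the Gelfond–Lifschitz reduct P^(upper I) and upper J models P^(lower I).
module Submission where

open import Defs
open import Data.Bool using (Bool; true; false; _∧_)
open import Data.Product using (_×_; _,_; proj₁; proj₂)
open import Data.Product.Function.NonDependent.Propositional using (_×-⇔_)
open import Data.Sum using (inj₁; inj₂)
open import Data.List using ([]; _∷_; map)
open import Data.List.Relation.Unary.All as All using (All; []; _∷_)
open import Data.List.Relation.Unary.All.Properties using (++↔; map⁺; map⁻)
open import Function using (_∘_; id; const)
open import Function.Bundles using (_⇔_; mk⇔; module Equivalence)
open import Function.Properties.Equivalence using ()
  renaming (refl to ⇔-refl; trans to ⇔-trans; sym to ⇔-sym)
open import Function.Properties.Inverse using (↔⇒⇔)
open import Relation.Binary.PropositionalEquality using (_≡_; _≢_; refl; sym; trans; cong)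
open import Relation.Nullary using (contradiction)

open Equivalence using (to; from)

lo : V3 → Bool
lo 𝟏 = true
lo _ = false

hi : V3 → Bool
hi 𝟎 = false
hi _ = true

fromBounds : Bool → Bool → V3
fromBounds true  _     = 𝟏
fromBounds false true  = ⋆
fromBounds false false = 𝟎

lo-fromBounds : ∀ x y → lo (fromBounds x y) ≡ x
lo-fromBounds true  _     = refl
lo-fromBounds false true  = refl
lo-fromBounds false false = refl

hi-fromBounds : ∀ x y → (x ≡ true → y ≡ true) → hi (fromBounds x y) ≡ y
hi-fromBounds true  _     x⇒y = sym (x⇒y refl)
hi-fromBounds false true  _   = refl
hi-fromBounds false false _   = refl

fromBounds-≤s : ∀ {x} y y' → (lo x ≡ true → y ≡ true) → (y ≡ true → y' ≡ true) →
                (y' ≡ true → hi x ≡ true) → fromBounds y y' ≤s x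
fromBounds-≤s {⋆} _     _     _ _   _ = inj₂ refl
fromBounds-≤s {𝟏} true  _     _ _   _ = inj₁ refl
fromBounds-≤s {𝟏} false _     l _   _ = contradiction (l refl) λ ()
fromBounds-≤s {𝟎} false false _ _   _ = inj₁ refl
fromBounds-≤s {𝟎} false true  _ _   u = contradiction (u refl) λ ()
fromBounds-≤s {𝟎} true  _     _ y⇒y' u = contradiction (u (y⇒y' refl)) λ ()

lo⇒hi : ∀ x → lo x ≡ true → hi x ≡ true
lo⇒hi 𝟏 _ = refl

lo≡true⇔≡𝟏 : ∀ {x} → lo x ≡ true ⇔ x ≡ 𝟏
lo≡true⇔≡𝟏 {𝟏} = mk⇔ (const refl) (const refl)
lo≡true⇔≡𝟏 {𝟎} = mk⇔ (λ ()) (λ ())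
lo≡true⇔≡𝟏 {⋆} = mk⇔ (λ ()) (λ ())

hi≢true⇒≢𝟏 : ∀ {x} → hi x ≢ true → x ≢ 𝟏
hi≢true⇒≢𝟏 h refl = h refl

≤t⇔bounds : ∀ {x y} → x ≤t y ⇔ ((lo x ≡ true → lo y ≡ true) × (hi x ≡ true → hi y ≡ true))
≤t⇔bounds = mk⇔ ≤t⇒bounds bounds⇒≤t
  where
  ≤t⇒bounds : ∀ {x y} → x ≤t y → (lo x ≡ true → lo y ≡ true) × (hi x ≡ true → hi y ≡ true)
  ≤t⇒bounds 0≤  = (λ ()) , (λ ())
  ≤t⇒bounds ≤1  = const refl , const refl
  ≤t⇒bounds ⋆≤⋆ = (λ ()) , const refl

  bounds⇒≤t : ∀ {x y} → (lo x ≡ true → lo y ≡ true) × (hi x ≡ true → hi y ≡ true) → x ≤t y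
  bounds⇒≤t {𝟎} _ = 0≤
  bounds⇒≤t {_} {𝟏} _ = ≤1
  bounds⇒≤t {⋆} {⋆} _ = ⋆≤⋆
  bounds⇒≤t {𝟏} {𝟎} (l , _) = contradiction (l refl) λ ()
  bounds⇒≤t {𝟏} {⋆} (l , _) = contradiction (l refl) λ ()
  bounds⇒≤t {⋆} {𝟎} (_ , u) = contradiction (u refl) λ ()

toV3≡⇔bounds : ∀ b x →
  (x ≢ ⋆ → toV3 b ≡ x) ⇔ ((lo x ≡ true → b ≡ true) × (b ≡ true → hi x ≡ true))
toV3≡⇔bounds _     ⋆ = mk⇔ (const ((λ ()) , const refl)) (const (contradiction refl))
toV3≡⇔bounds true  𝟏 = mk⇔ (const (const refl , const refl)) (const (const refl))
toV3≡⇔bounds false 𝟎 = mk⇔ (const ((λ ()) , λ ())) (const (const refl))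
toV3≡⇔bounds false 𝟏 = mk⇔ (λ h → contradiction (h λ ()) λ ())
                           (λ (l , _) → contradiction (l refl) λ ())
toV3≡⇔bounds true  𝟎 = mk⇔ (λ h → contradiction (h λ ()) λ ())
                           (λ (_ , u) → contradiction (u refl) λ ())

lo-∧₃ : ∀ x y → lo (x ∧₃ y) ≡ lo x ∧ lo y
lo-∧₃ 𝟎 _ = refl
lo-∧₃ 𝟏 _ = refl
lo-∧₃ ⋆ 𝟎 = refl
lo-∧₃ ⋆ 𝟏 = refl
lo-∧₃ ⋆ ⋆ = refl

hi-∧₃ : ∀ x y → hi (x ∧₃ y) ≡ hi x ∧ hi y
hi-∧₃ 𝟎 _ = refl
hi-∧₃ 𝟏 _ = refl
hi-∧₃ ⋆ 𝟎 = refl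
hi-∧₃ ⋆ 𝟏 = refl
hi-∧₃ ⋆ ⋆ = refl

∧≡true⇔ : ∀ {x y} → x ∧ y ≡ true ⇔ (x ≡ true × y ≡ true)
∧≡true⇔ {true}  = mk⇔ (refl ,_) proj₂
∧≡true⇔ {false} = mk⇔ (λ ()) (λ { (() , _) })

conj≡true⇔All : (h : V3 → Bool) → h 𝟏 ≡ true → (∀ x y → h (x ∧₃ y) ≡ h x ∧ h y) →
                ∀ xs → h (conj xs) ≡ true ⇔ All (λ x → h x ≡ true) xs
conj≡true⇔All h h𝟏 h∧₃ [] = mk⇔ (const []) (const h𝟏)
conj≡true⇔All h h𝟏 h∧₃ (x ∷ xs) = mk⇔
  (λ e → let hx , hxs = to ∧≡true⇔ (trans (sym (h∧₃ x (conj xs))) e) in hx ∷ to ih hxs)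
  (λ { (hx ∷ hxs) → trans (h∧₃ x (conj xs)) (from ∧≡true⇔ (hx , from ih hxs)) })
  where ih = conj≡true⇔All h h𝟏 h∧₃ xs

All-map⇔ : ∀ {A B : Set} {Q : B → Set} {f : A → B} {xs} → All Q (map f xs) ⇔ All (Q ∘ f) xs
All-map⇔ = mk⇔ map⁻ map⁺

module Bounds (Σ' : Signature) where
  open Semantics Σ'

  lower upper : Interp3 → Interp2
  lower I a = lo (I a)
  upper I a = hi (I a)

  interval : Interp2 → Interp2 → Interp3
  interval K K' a = fromBounds (K a) (K' a)

  _⊆_ : Interp2 → Interp2 → Set
  K ⊆ K' = ∀ a → K a ≡ true → K' a ≡ true

  _≐_ : Interp2 → Interp2 → Set
  K ≐ K' = ∀ a → K a ≡ K' a

  ⊆-refl : ∀ {K} → K ⊆ K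
  ⊆-refl _ = id

  ⊆-trans : ∀ {K K' K''} → K ⊆ K' → K' ⊆ K'' → K ⊆ K''
  ⊆-trans p q a = q a ∘ p a

  ≐⇒⊆ : ∀ {K K'} → K ≐ K' → K ⊆ K'
  ≐⇒⊆ K≐K' a = trans (sym (K≐K' a))

  ≐⇒⊇ : ∀ {K K'} → K ≐ K' → K' ⊆ K
  ≐⇒⊇ K≐K' a = trans (K≐K' a)

  lower⊆upper : ∀ I → lower I ⊆ upper I
  lower⊆upper I a = lo⇒hi (I a)

  lower-interval : ∀ K K' → lower (interval K K') ≐ K
  lower-interval K K' a = lo-fromBounds (K a) (K' a)

  upper-interval : ∀ {K K'} → K ⊆ K' → upper (interval K K') ≐ K'
  upper-interval {K} {K'} K⊆K' a = hi-fromBounds (K a) (K' a) (K⊆K' a)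

  ∈[]⇔ : ∀ {J I} → J ∈[ I ] ⇔ (lower I ⊆ J × J ⊆ upper I)
  ∈[]⇔ {J} {I} = mk⇔
    (λ J∈I → (λ a → proj₁ (to (toV3≡⇔bounds (J a) (I a)) (J∈I a)))
           , (λ a → proj₂ (to (toV3≡⇔bounds (J a) (I a)) (J∈I a))))
    (λ (l , h) → λ a → from (toV3≡⇔bounds (J a) (I a)) (l a , h a))

  lower∈[] : ∀ I → lower I ∈[ I ]
  lower∈[] I = from ∈[]⇔ (⊆-refl , lower⊆upper I)

  upper∈[] : ∀ I → upper I ∈[ I ]
  upper∈[] I = from ∈[]⇔ (lower⊆upper I , ⊆-refl)

  ∈interval⇔ : ∀ {J K K'} → K ⊆ K' → J ∈[ interval K K' ] ⇔ (K ⊆ J × J ⊆ K')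
  ∈interval⇔ {J} {K} {K'} K⊆K' = mk⇔
    (λ J∈ → let l , h = to ∈[]⇔ J∈ in
      ⊆-trans (≐⇒⊇ (lower-interval K K')) l , ⊆-trans h (≐⇒⊆ (upper-interval K⊆K')))
    (λ (l , h) → from ∈[]⇔
      (⊆-trans (≐⇒⊆ (lower-interval K K')) l , ⊆-trans h (≐⇒⊇ (upper-interval K⊆K'))))

  ∈[]-convex : ∀ {I J K K'} → K ∈[ I ] → K' ∈[ I ] → K ⊆ K' → J ∈[ interval K K' ] → J ∈[ I ]
  ∈[]-convex K∈I K'∈I K⊆K' J∈ =
    let J-lo , J-hi = to (∈interval⇔ K⊆K') J∈ in
    from ∈[]⇔ (⊆-trans (proj₁ (to ∈[]⇔ K∈I)) J-lo , ⊆-trans J-hi (proj₂ (to ∈[]⇔ K'∈I)))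

  interval-≤s : ∀ {I K K'} → K ∈[ I ] → K' ∈[ I ] → K ⊆ K' → interval K K' ≤s-I I
  interval-≤s {I} {K} {K'} K∈I K'∈I K⊆K' a =
    fromBounds-≤s (K a) (K' a) (proj₁ (to ∈[]⇔ K∈I) a) (K⊆K' a) (proj₂ (to ∈[]⇔ K'∈I) a)

  bounds⇒≤t-I : ∀ {I J} → lower I ⊆ lower J → upper I ⊆ upper J → I ≤t-I J
  bounds⇒≤t-I l h a = from ≤t⇔bounds (l a , h a)

module Stability (Σ' : Signature) (P : Program Σ') where
  open Semantics Σ'
  open Bounds Σ'

  F-antitone : ∀ {J J' K K'} → IsF P J K → IsF P J' K' → J ⊆ J' → K' ⊆ K
  F-antitone (K-model , _) (_ , K'-least) J⊆J' =
    K'-least _ λ k kept → K-model k (All.map (λ {b} J'b≢true → J'b≢true ∘ J⊆J' b) kept)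

  IsF-resp-≐ : ∀ {J K K'} → IsF P J K → K ≐ K' → IsF P J K'
  IsF-resp-≐ (K-model , K-least) K≐K' =
    (λ k kept pos → ≐⇒⊆ K≐K' _ (K-model k kept (All.map (≐⇒⊇ K≐K' _) pos))) ,
    (λ K'' K''-model → ⊆-trans (≐⇒⊇ K≐K') (K-least K'' K''-model))

  -- The atom u is valued ⋆: it keeps a reduct body from being true, never from being non-false.
  lo-negToU⇔ : ∀ J I bs →
    All (λ l → lo (evalLit J l) ≡ true) (negToU I bs) ⇔ All (λ b → hi (I b) ≢ true) bs
  lo-negToU⇔ J I [] = mk⇔ (const []) (const [])
  lo-negToU⇔ J I (b ∷ bs) with I b in Ib≡
  ... | 𝟎 = mk⇔ (λ h → (λ e → contradiction (trans (sym (cong hi Ib≡)) e) λ ()) ∷ to ih h)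
                (λ { (_ ∷ h) → from ih h })
    where ih = lo-negToU⇔ J I bs
  ... | 𝟏 = mk⇔ (λ { (() ∷ _) }) (λ { (≢true ∷ _) → contradiction (cong hi Ib≡) ≢true })
  ... | ⋆ = mk⇔ (λ { (() ∷ _) }) (λ { (≢true ∷ _) → contradiction (cong hi Ib≡) ≢true })

  hi-negToU : ∀ J I bs → All (λ l → hi (evalLit J l) ≡ true) (negToU I bs)
  hi-negToU J I [] = []
  hi-negToU J I (b ∷ bs) with I b
  ... | 𝟎 = hi-negToU J I bs
  ... | 𝟏 = refl ∷ hi-negToU J I bs
  ... | ⋆ = refl ∷ hi-negToU J I bs

  reductBodyValue : Interp3 → Interp3 → GRule Σ' → V3
  reductBodyValue I J r = conj (map (evalLit J) (reductBody I r))

  reductBodyValue≡true⇔ : (h : V3 → Bool) → h 𝟏 ≡ true → (∀ x y → h (x ∧₃ y) ≡ h x ∧ h y) →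
    ∀ I J r → h (reductBodyValue I J r) ≡ true ⇔
      (All (λ a → h (J a) ≡ true) (GRule.bpos r) ×
       All (λ l → h (evalLit J l) ≡ true) (negToU I (GRule.bneg r)))
  reductBodyValue≡true⇔ h h𝟏 h∧₃ I J r =
    ⇔-trans (conj≡true⇔All h h𝟏 h∧₃ _) (
    ⇔-trans All-map⇔ (
    ⇔-trans (⇔-sym (↔⇒⇔ ++↔)) (All-map⇔ ×-⇔ ⇔-refl)))

  lo-reductBodyValue⇔ : ∀ I J r → lo (reductBodyValue I J r) ≡ true ⇔
    (All (λ a → lower J a ≡ true) (GRule.bpos r) × KeptGL (upper I) r)
  lo-reductBodyValue⇔ I J r =
    ⇔-trans (reductBodyValue≡true⇔ lo refl lo-∧₃ I J r) (⇔-refl ×-⇔ lo-negToU⇔ J I _)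

  hi-reductBodyValue⇔ : ∀ I J r → hi (reductBodyValue I J r) ≡ true ⇔
    All (λ a → upper J a ≡ true) (GRule.bpos r)
  hi-reductBodyValue⇔ I J r =
    ⇔-trans (reductBodyValue≡true⇔ hi refl hi-∧₃ I J r) (mk⇔ proj₁ (_, hi-negToU J I (GRule.bneg r)))

  modelOfReduct⇔ : ∀ {I J} → ModelOfReduct P I J ⇔
    (ModelOfGL P (upper I) (lower J) × ModelOfGL P (lower I) (upper J))
  modelOfReduct⇔ {I} {J} = mk⇔
    (λ J-model →
      (λ k kept pos → proj₁ (to ≤t⇔bounds (J-model k (All.map hi≢true⇒≢𝟏 kept)))
                            (from (lo-reductBodyValue⇔ I J (gr Σ' P k)) (pos , kept))) ,
      (λ k kept pos → proj₂ (to ≤t⇔bounds (J-model k (All.map (_∘ from lo≡true⇔≡𝟏) kept)))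
                            (from (hi-reductBodyValue⇔ I J (gr Σ' P k)) pos)))
    (λ (lower-model , upper-model) k kept → from ≤t⇔bounds
      ( (λ body → let pos , kept-upper = to (lo-reductBodyValue⇔ I J (gr Σ' P k)) body in
                  lower-model k kept-upper pos)
      , (λ body → upper-model k (All.map (_∘ to lo≡true⇔≡𝟏) kept)
                              (to (hi-reductBodyValue⇔ I J (gr Σ' P k)) body))))

  alternatingFixpoint⇒stablePartialModel : ∀ {I} →
    IsF P (upper I) (lower I) → IsF P (lower I) (upper I) → StablePartialModel P I
  alternatingFixpoint⇒stablePartialModel (lower-model , lower-least) (upper-model , upper-least) =
    from modelOfReduct⇔ (lower-model , upper-model) ,
    λ J J-model → let M₁ , M₂ = to modelOfReduct⇔ J-model in
                  bounds⇒≤t-I (lower-least _ M₁) (upper-least _ M₂)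

  module Contraction {I FU FL} (FU-isF : IsF P (upper I) FU) (FL-isF : IsF P (lower I) FL) where

    FU⊆FL : FU ⊆ FL
    FU⊆FL = F-antitone FL-isF FU-isF (lower⊆upper I)

    F-maps-into-interval : ∀ {J K} → J ∈[ I ] → IsF P J K → K ∈[ interval FU FL ]
    F-maps-into-interval J∈I K-isF =
      let lower⊆J , J⊆upper = to ∈[]⇔ J∈I in
      from (∈interval⇔ FU⊆FL) (F-antitone K-isF FU-isF J⊆upper , F-antitone FL-isF K-isF lower⊆J)

    interval-stableTrapSpace : FImageSubset P (_∈[ I ]) → FU ∈[ I ] → FL ∈[ I ] →
                               StableTrapSpace P (interval FU FL)
    interval-stableTrapSpace closed FU∈I FL∈I =
      (FU , from (∈interval⇔ FU⊆FL) (⊆-refl , FU⊆FL)) ,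
      λ J J∈ → let J∈I = ∈[]-convex FU∈I FL∈I FU⊆FL J∈
                   K , _ , K-isF = closed J J∈I
               in K , F-maps-into-interval J∈I K-isF , K-isF

    stableClass⊆interval : ∀ {S} → SubsetFImage P S → S ⊆[ I ] → S ⊆[ interval FU FL ]
    stableClass⊆interval S⊆F[S] S⊆I K K∈S =
      let J , J∈S , K-isF = S⊆F[S] K K∈S in F-maps-into-interval (S⊆I J J∈S) K-isF

  stTrapClosure⇒alternatingFixpoint : ∀ {S I} → SubsetFImage P S → IsStTrapClosure P S I →
    IsF P (upper I) (lower I) × IsF P (lower I) (upper I)
  stTrapClosure⇒alternatingFixpoint {I = I} S⊆F[S] ((_ , closed) , S⊆I , minimal)
    with closed (upper I) (upper∈[] I) | closed (lower I) (lower∈[] I)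
  ... | FU , FU∈I , FU-isF | FL , FL∈I , FL-isF =
    IsF-resp-≐ FU-isF (λ a → trans (sym (lower-interval FU FL a)) (cong lo (interval≡I a))) ,
    IsF-resp-≐ FL-isF (λ a → trans (sym (upper-interval FU⊆FL a)) (cong hi (interval≡I a)))
    where
    open Contraction FU-isF FL-isF

    interval≡I : ∀ a → interval FU FL a ≡ I a
    interval≡I = minimal (interval FU FL)
      (interval-stableTrapSpace closed FU∈I FL∈I)
      (stableClass⊆interval S⊆F[S] S⊆I)
      (interval-≤s FU∈I FL∈I FU⊆FL)

proposition4p5 : (Σ' : Signature) (P : Program Σ') (S : Semantics.SetOfInterp Σ') →
    Semantics.StableClass Σ' P S →
    (I : Semantics.Interp3 Σ') → Semantics.IsStTrapClosure Σ' P S I →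
    Semantics.StablePartialModel Σ' P I
proposition4p5 Σ' P S (_ , _ , S⊆F[S]) I I-closure =
  let fixpoint-lower , fixpoint-upper = stTrapClosure⇒alternatingFixpoint S⊆F[S] I-closure in
  alternatingFixpoint⇒stablePartialModel fixpoint-lower fixpoint-upper
  where open Stability Σ' P
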